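{- Let $\mu$ be a partition of $n$ with staircase rank $k$. Then $\mathcal{N}_\mu=\{t\in\mathbb{Z}: t\ge k+1\}$.
   Context: A partition is an infinite weakly decreasing sequence $\mu_1\ge\mu_2\ge\cdots$ of nonnegative integers with finitely many nonzero terms (rows $i\ge1$ include rows with $\mu_i=0$). Row $i$ of $\mu$ is salient if there exists $j>i$ with $i+\mu_i\ge j+\mu_j$. $\mathcal{N}_\mu$ is the multiset $\{i+\mu_i: i\ge1,\ \text{row } i \text{ is not salient in } \mu\}$. The staircase rank of $\mu$ is the largest integer $k$ such that $\mu_i\ge k-i+1$ for $1\le i\le k$. -}

module Defs where

open import Data.Nat using (ℕ; zero; suc; _+_; _≤_; _<_)
open import Data.List using (List; []; _∷_; map)
open import Data.Nat.ListAction using (sum)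
open import Data.Product using (Σ; _×_; ∃-syntax)
open import Relation.Binary.PropositionalEquality using (_≡_)
open import Relation.Nullary using (¬_)

-- A sequence μ : ℕ → ℕ; row i (for i ≥ 1) has length μ i.  The value μ 0 is
-- ignored by every definition below (rows are indexed from 1, as in the paper).

rows : ℕ → List ℕ
rows zero    = []
rows (suc N) = rows N Data.List.++ (suc N ∷ [])

WeaklyDecreasing : (ℕ → ℕ) → Set
WeaklyDecreasing μ = ∀ i → 1 ≤ i → μ (suc i) ≤ μ i

IsPartitionOf : (ℕ → ℕ) → ℕ → Set
IsPartitionOf μ n =
  WeaklyDecreasing μ ×
  (∃[ N ] ((∀ i → N < i → μ i ≡ 0) × sum (map μ (rows N)) ≡ n))

Salient : (ℕ → ℕ) → ℕ → Set
Salient μ i = ∃[ j ] (i < j × j + μ j ≤ i + μ i)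

-- μ_i ≥ k - i + 1 for 1 ≤ i ≤ k  (written without truncated subtraction)
StaircaseBound : (ℕ → ℕ) → ℕ → Set
StaircaseBound μ k = ∀ i → 1 ≤ i → i ≤ k → k + 1 ≤ μ i + i

IsStaircaseRank : (ℕ → ℕ) → ℕ → Set
IsStaircaseRank μ k = StaircaseBound μ k × (∀ k′ → StaircaseBound μ k′ → k′ ≤ k)

-- t occurs in the multiset 𝒩_μ with multiplicity exactly one
OccursOnceInN : (ℕ → ℕ) → ℕ → Set
OccursOnceInN μ t =
  ∃[ i ] ((1 ≤ i × ¬ Salient μ i × i + μ i ≡ t) ×
          (∀ i′ → 1 ≤ i′ → ¬ Salient μ i′ → i′ + μ i′ ≡ t → i′ ≡ i))

NotInN : (ℕ → ℕ) → ℕ → Set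
NotInN μ t = ∀ i → 1 ≤ i → ¬ Salient μ i → ¬ (i + μ i ≡ t)

module Submission where

-- Write a_i = i + μ_i for the "diagonal position" of the end of row i.
-- Row i is non-salient exactly when a_j > a_i for every j > i, so 𝒩_μ
-- collects the values a_i that are strict minima of the tail a_i, a_{i+1}, ….
-- The proof rests on three facts about this sequence:
--   * a_{i+1} ≤ a_i + 1, because μ is weakly decreasing;
--   * a_i ≥ k + 1 for every row, by the staircase bound for i ≤ k
--     and trivially for i > k, so no t ≤ k lies in 𝒩_μ;
--   * some row has a_i ≤ k + 1, since otherwise k + 1 would also satisfy
--     the staircase bound, contradicting maximality of the rank k.
-- Given t ≥ k + 1, some row has a_i ≤ t, and a_j = j > t for j large, so
-- there is a LAST row i with a_i ≤ t (lemma lastAtMost).  Unit steps force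
-- a_i = t, every later row ends beyond t, so row i is non-salient, and it
-- is the only non-salient row with a_i = t (lemma occursOnce-ofLast).

open import Defs
open import Data.Nat using (ℕ; zero; suc; _+_; _≤_; _<_; _≤?_; z≤n; s≤s)
open import Data.Nat.Properties
open import Data.Product using (_×_; _,_; ∃-syntax)
open import Data.Sum using (_⊎_; inj₁; inj₂)
open import Data.Empty using (⊥-elim)
open import Relation.Nullary using (¬_; Dec; yes; no; contradiction)
open import Relation.Binary.PropositionalEquality
open import Relation.Binary.Definitions using (tri<; tri≈; tri>)

searchUpTo : (P : ℕ → Set) → (∀ i → Dec (P i)) → ∀ b →
  (∀ i → 1 ≤ i → i ≤ b → P i) ⊎ ∃[ i ] (1 ≤ i × ¬ P i)
searchUpTo P P? zero = inj₁ (λ i 1≤i i≤0 → contradiction i≤0 (<⇒≱ 1≤i))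
searchUpTo P P? (suc b) with searchUpTo P P? b | P? (suc b)
... | inj₂ failure | _      = inj₂ failure
... | inj₁ _       | no ¬p  = inj₂ (suc b , s≤s z≤n , ¬p)
... | inj₁ holds   | yes p  = inj₁ extend
  where
  extend : ∀ i → 1 ≤ i → i ≤ suc b → P i
  extend i 1≤i i≤1+b with m≤n⇒m<n∨m≡n i≤1+b
  ... | inj₁ i<1+b = holds i 1≤i (m<1+n⇒m≤n i<1+b)
  ... | inj₂ refl  = p

lastAtMost : (f : ℕ → ℕ) (t m : ℕ) → f m ≤ t → ∀ B → m ≤ B →
  (∀ j → B < j → t < f j) →
  ∃[ i ] (m ≤ i × f i ≤ t × (∀ j → i < j → t < f j))
lastAtMost f t m fm≤t zero m≤0 beyond = m , ≤-refl , fm≤t , λ j m<j →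
  beyond j (≤-trans (s≤s z≤n) (subst (_< j) (n≤0⇒n≡0 m≤0) m<j))
lastAtMost f t m fm≤t (suc B) m≤1+B beyond with f (suc B) ≤? t
... | yes fB≤t = suc B , m≤1+B , fB≤t , beyond
... | no fB≰t with m≤n⇒m<n∨m≡n m≤1+B
...   | inj₂ refl = contradiction fm≤t fB≰t
...   | inj₁ m<1+B = lastAtMost f t m fm≤t B (m<1+n⇒m≤n m<1+B) beyond′
  where
  beyond′ : ∀ j → B < j → t < f j
  beyond′ j B<j with m≤n⇒m<n∨m≡n B<j
  ... | inj₁ 1+B<j = beyond j 1+B<j
  ... | inj₂ refl  = ≰⇒> fB≰t

unitSteps : (μ : ℕ → ℕ) → WeaklyDecreasing μ →
  ∀ i → 1 ≤ i → suc i + μ (suc i) ≤ suc (i + μ i)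
unitSteps μ dec i 1≤i = s≤s (+-monoʳ-≤ i (dec i 1≤i))

-- Beyond the nonzero rows a row ends at its own index, so eventually every
-- row ends beyond any given t.
eventuallyBeyond : (μ : ℕ → ℕ) (N : ℕ) → (∀ i → N < i → μ i ≡ 0) →
  ∀ t j → N + t < j → t < j + μ j
eventuallyBeyond μ N vanish t j N+t<j = begin-strict
  t         ≤⟨ m≤n+m t N ⟩
  N + t     <⟨ N+t<j ⟩
  j         ≡⟨ sym (+-identityʳ j) ⟩
  j + 0     ≡⟨ cong (j +_) (sym (vanish j N<j)) ⟩
  j + μ j   ∎
  where
  open ≤-Reasoning
  N<j : N < j
  N<j = ≤-trans (s≤s (m≤m+n N t)) N+t<j

rowsEndBeyondRank : (μ : ℕ → ℕ) (k : ℕ) → StaircaseBound μ k →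
  ∀ i → 1 ≤ i → k < i + μ i
rowsEndBeyondRank μ k bound i 1≤i with i ≤? k
... | yes i≤k = subst₂ _≤_ (+-comm k 1) (+-comm (μ i) i) (bound i 1≤i i≤k)
... | no i≰k  = ≤-trans (≰⇒> i≰k) (m≤m+n i (μ i))

rowEndingAtRank : (μ : ℕ → ℕ) (k : ℕ) → IsStaircaseRank μ k →
  ∃[ i ] (1 ≤ i × i + μ i ≤ k + 1)
rowEndingAtRank μ k (_ , maximal)
  with searchUpTo (λ i → k + 1 + 1 ≤ μ i + i) (λ i → k + 1 + 1 ≤? μ i + i) (k + 1)
... | inj₁ bound = contradiction (maximal (k + 1) bound)
                     (<⇒≱ (subst (k <_) (+-comm 1 k) ≤-refl))
... | inj₂ (i , 1≤i , violated) = i , 1≤i , end≤k+1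
  where
  end≤k+1 : i + μ i ≤ k + 1
  end≤k+1 = subst (_≤ k + 1) (+-comm (μ i) i)
    (m<1+n⇒m≤n (subst (μ i + i <_) (+-comm (k + 1) 1) (≰⇒> violated)))

-- If row i ends at or before t and every later row ends beyond t, then by
-- unit steps row i ends exactly at t.
lastRowHitsExactly : (μ : ℕ → ℕ) → WeaklyDecreasing μ → ∀ t i → 1 ≤ i →
  i + μ i ≤ t → (∀ j → i < j → t < j + μ j) → i + μ i ≡ t
lastRowHitsExactly μ dec t i 1≤i end≤t later =
  ≤-antisym end≤t (≤-pred (≤-trans (later (suc i) ≤-refl) (unitSteps μ dec i 1≤i)))

-- A row ending at t after which every row ends beyond t is non-salient, and
-- it is the only non-salient row ending at t: an earlier such row would be
-- salient because of row i, a later one ends beyond t.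
occursOnce-ofLast : (μ : ℕ → ℕ) (t i : ℕ) → 1 ≤ i → i + μ i ≡ t →
  (∀ j → i < j → t < j + μ j) → OccursOnceInN μ t
occursOnce-ofLast μ t i 1≤i end≡t later =
  i , (1≤i , nonSalient , end≡t) , unique
  where
  nonSalient : ¬ Salient μ i
  nonSalient (j , i<j , endj≤endi) =
    <⇒≱ (later j i<j) (subst (j + μ j ≤_) end≡t endj≤endi)
  unique : ∀ i′ → 1 ≤ i′ → ¬ Salient μ i′ → i′ + μ i′ ≡ t → i′ ≡ i
  unique i′ _ nonSalient′ end′≡t with <-cmp i′ i
  ... | tri≈ _ i′≡i _ = i′≡i
  ... | tri< i′<i _ _ = ⊥-elim (nonSalient′ (i , i′<i , ≤-reflexive (trans end≡t (sym end′≡t))))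
  ... | tri> _ _ i<i′ = ⊥-elim (<⇒≱ (later i′ i<i′) (≤-reflexive end′≡t))

lemma13 : (μ : ℕ → ℕ) (n k : ℕ) → IsPartitionOf μ n → IsStaircaseRank μ k →
    ∀ t → (k + 1 ≤ t → OccursOnceInN μ t) × (t ≤ k → NotInN μ t)
lemma13 μ n k (dec , N , vanish , _) rank@(bound , _) t = occurs , absent
  where
  absent : t ≤ k → NotInN μ t
  absent t≤k i 1≤i _ refl = <⇒≱ (rowsEndBeyondRank μ k bound i 1≤i) t≤k
  occurs : k + 1 ≤ t → OccursOnceInN μ t
  occurs k+1≤t with rowEndingAtRank μ k rank
  ... | i₀ , 1≤i₀ , end₀≤k+1
    with lastAtMost (λ i → i + μ i) t i₀ end₀≤t (N + t)
           (≤-trans (m≤m+n i₀ (μ i₀)) (≤-trans end₀≤t (m≤n+m t N)))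
           (eventuallyBeyond μ N vanish t)
    where
    end₀≤t : i₀ + μ i₀ ≤ t
    end₀≤t = ≤-trans end₀≤k+1 k+1≤t
  ... | i , i₀≤i , end≤t , later =
    occursOnce-ofLast μ t i 1≤i (lastRowHitsExactly μ dec t i 1≤i end≤t later) later
    where
    1≤i : 1 ≤ i
    1≤i = ≤-trans 1≤i₀ i₀≤i
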